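{- Let $G$ be a $2$-connected $2$-leaf-stable graph with fault cost $1$, let $a_1,a_2\in V(G)$ be vertices such that $G$ has a hamiltonian $a_1a_2$-path and $G-z$ has a hamiltonian $a_1a_2$-path for every $z\in V(G)\setminus\{a_1,a_2\}$, let $\{x,y\}$ be a $2$-separator of $G$ with $xy\in E(G)$, and let $G_1,G_2$ be the two $2$-fragments of $G$ with attachment $\{x,y\}$, where $a_i\in V(G_i)$ for $i=1,2$. Then for $i=1,2$ there is a hamiltonian $a_ix$-path or a hamiltonian $a_iy$-path in $G_i$, and also in $G_i-v$ for every $v\in V(G_i)\setminus\{a_i\}$.
   Context: Graphs are finite, simple and undirected. A graph is hamiltonian if it has a cycle through all its vertices ($K_1,K_2$ are not); a hamiltonian $ab$-path is a path through all vertices with end-vertices $a,b$. The minimum leaf number ${\rm ml}(G)$ is $1$ if $G$ is hamiltonian, $\infty$ if $G$ is disconnected, and otherwise the minimum number of leaves of a spanning tree. $G$ is $2$-leaf-stable if ${\rm ml}(G)=2$ and ${\rm ml}(G-v)=2$ for all $v$. An ml-subgraph of $G$ is a hamiltonian cycle if $G$ is hamiltonian, and otherwise a spanning tree with ${\rm ml}(G)$ leaves; ${\cal S}_{\rm ml}(G)$ is the set of ml-subgraphs. For $S\in{\cal S}_{\rm ml}(G)$, $v\in V(G)$, $S_v\in{\cal S}_{\rm ml}(G-v)$, $\tau(S,S_v)=|\{u\in V(G)\setminus\{v\}:\deg_S(u)\ne\deg_{S_v}(u)\}|$, $\varphi_S(G)=\max_{v}\min_{S_v}\tau(S,S_v)$,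 fault cost $\varphi(G)=\min_{S}\varphi_S(G)$. A $2$-separator of a connected graph $G$ is a set $X$ of two vertices with $G-X$ disconnected; for a component $H$ of $G-X$, $G[V(H)\cup X]$ is a $2$-fragment with attachment $X$. (For such $G$, $a_1,a_2$, $\{x,y\}$ there are exactly two $2$-fragments with attachment $\{x,y\}$, one containing $a_1$ and the other $a_2$.) -}

module Defs where

open import Data.Nat using (ℕ; zero; suc; _≤_; _≡ᵇ_)
open import Data.Fin using (Fin; _≟_)
open import Data.Bool using (Bool; true; false; _∧_; _∨_; not; if_then_else_)
open import Data.List using (List; []; _∷_; length; map; allFin; head; last)
open import Data.Nat.ListAction using (sum)
open import Data.List.Relation.Unary.All using (All)
open import Data.List.Relation.Unary.Unique.Propositional using (Unique)
open import Data.List.Membership.Propositional using (_∈_)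
open import Data.Maybe using (Maybe; just)
open import Data.Product using (Σ; ∃; _×_; _,_)
open import Data.Sum using (_⊎_)
open import Relation.Nullary using (¬_)
open import Relation.Nullary.Decidable using (⌊_⌋)
open import Relation.Binary.PropositionalEquality using (_≡_; _≢_)
open import Function.Bundles using (_⇔_)

record Graph (n : ℕ) : Set where
  field
    adj    : Fin n → Fin n → Bool
    sym    : ∀ u w → adj u w ≡ adj w u
    irrefl : ∀ u → adj u u ≡ false
open Graph public

VSet : ℕ → Set
VSet n = Fin n → Bool

ESet : ℕ → Set
ESet n = Fin n → Fin n → Bool

full : ∀ {n} → VSet n
full _ = true

_─_ : ∀ {n} → VSet n → Fin n → VSet n
(S ─ v) u = S u ∧ not ⌊ u ≟ v ⌋

b2n : Bool → ℕ
b2n true  = 1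
b2n false = 0

countV : ∀ {n} → (Fin n → Bool) → ℕ
countV {n} p = sum (map (λ u → b2n (p u)) (allFin n))

deg : ∀ {n} → ESet n → Fin n → ℕ
deg T u = countV (T u)

data Consec {A : Set} : List A → A → A → Set where
  here  : ∀ {a b xs} → Consec (a ∷ b ∷ xs) a b
  there : ∀ {x a b xs} → Consec xs a b → Consec (x ∷ xs) a b

Chain : ∀ {n} → ESet n → List (Fin n) → Set
Chain R vs = ∀ a b → Consec vs a b → R a b ≡ true

Walk : ∀ {n} → ESet n → VSet n → Fin n → Fin n → List (Fin n) → Set
Walk R S u w vs = Chain R vs × All (λ z → S z ≡ true) vs
                  × head vs ≡ just u × last vs ≡ just w

ConnectedBy : ∀ {n} → ESet n → VSet n → Set
ConnectedBy R S = ∀ u w → S u ≡ true → S w ≡ true → ∃ λ vs → Walk R S u w vs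

Enumerates : ∀ {n} → VSet n → List (Fin n) → Set
Enumerates S vs = Unique vs × (∀ u → (u ∈ vs) ⇔ (S u ≡ true))

module _ {n : ℕ} (G : Graph n) where

  Connected : VSet n → Set
  Connected S = ConnectedBy (adj G) S

  HamPath : VSet n → Fin n → Fin n → Set
  HamPath S a b = ∃ λ vs → Enumerates S vs × Chain (adj G) vs
                         × head vs ≡ just a × last vs ≡ just b

  SubgraphOf : VSet n → ESet n → Set
  SubgraphOf S T = (∀ u w → T u w ≡ T w u)
                 × (∀ u w → T u w ≡ true → (adj G u w ≡ true × S u ≡ true × S w ≡ true))

  CycConsec : List (Fin n) → Fin n → Fin n → Set
  CycConsec vs u w = Consec vs u w ⊎ Consec vs w u
                   ⊎ (head vs ≡ just u × last vs ≡ just w)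
                   ⊎ (head vs ≡ just w × last vs ≡ just u)

  HamCycle : VSet n → ESet n → Set
  HamCycle S T = SubgraphOf S T
               × ∃ λ vs → Enumerates S vs × 3 ≤ length vs
                        × (∀ u w → (T u w ≡ true) ⇔ CycConsec vs u w)

  Hamiltonian : VSet n → Set
  Hamiltonian S = ∃ λ T → HamCycle S T

  HasCycle : ESet n → Set
  HasCycle T = ∃ λ vs → Unique vs × 3 ≤ length vs × Chain T vs
                       × ∃ λ a → ∃ λ b → head vs ≡ just a × last vs ≡ just b × T b a ≡ true

  SpanningTree : VSet n → ESet n → Set
  SpanningTree S T = SubgraphOf S T × ConnectedBy T S × ¬ HasCycle T

  leaves : VSet n → ESet n → ℕ
  leaves S T = countV (λ u → S u ∧ (deg T u ≡ᵇ 1))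

  MLIs : VSet n → ℕ → Set
  MLIs S k = (k ≡ 1 × Hamiltonian S)
           ⊎ (¬ Hamiltonian S × Connected S
              × (∃ λ T → SpanningTree S T × leaves S T ≡ k)
              × (∀ T → SpanningTree S T → k ≤ leaves S T))

  TwoLeafStable : Set
  TwoLeafStable = MLIs full 2 × (∀ v → MLIs (full ─ v) 2)

  MLSub : VSet n → ESet n → Set
  MLSub S T = HamCycle S T
            ⊎ (¬ Hamiltonian S × SpanningTree S T
               × (∀ T' → SpanningTree S T' → leaves S T ≤ leaves S T'))

  τ : ESet n → Fin n → ESet n → ℕ
  τ S v Sv = countV (λ u → not ⌊ u ≟ v ⌋ ∧ not (deg S u ≡ᵇ deg Sv u))

  MinTau : ESet n → Fin n → ℕ → Set
  MinTau S v m = (∃ λ Sv → MLSub (full ─ v) Sv × τ S v Sv ≡ m)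
               × (∀ Sv → MLSub (full ─ v) Sv → m ≤ τ S v Sv)

  PhiSIs : ESet n → ℕ → Set
  PhiSIs S m = (∀ v → ∃ λ k → MinTau S v k × k ≤ m) × (∃ λ v → MinTau S v m)

  FaultCostIs : ℕ → Set
  FaultCostIs m = (∃ λ S → MLSub full S × PhiSIs S m)
                × (∀ S → MLSub full S → ∀ k → PhiSIs S k → m ≤ k)

  TwoConnected : Set
  TwoConnected = 3 ≤ n × Connected full × (∀ v → Connected (full ─ v))

  IsComponentOf : VSet n → VSet n → Set
  IsComponentOf X C = (∃ λ u → C u ≡ true)
                    × (∀ u → C u ≡ true → X u ≡ true)
                    × Connected C
                    × (∀ u w → C u ≡ true → X w ≡ true → adj G u w ≡ true → C w ≡ true)

  TwoSeparator : Fin n → Fin n → Set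
  TwoSeparator x y = x ≢ y × ¬ Connected ((full ─ x) ─ y)

fragment : ∀ {n} → VSet n → Fin n → Fin n → VSet n
fragment C x y u = C u ∨ ⌊ u ≟ x ⌋ ∨ ⌊ u ≟ y ⌋

FragmentConclusion : ∀ {n} → Graph n → VSet n → Fin n → Fin n → Fin n → Set
FragmentConclusion G F a x y =
  (HamPath G F a x ⊎ HamPath G F a y)
  × (∀ v → F v ≡ true → v ≢ a → HamPath G (F ─ v) a x ⊎ HamPath G (F ─ v) a y)

{-# OPTIONS --safe #-}
module Submission where

-- Walk a hamiltonian path of G (or of G − v) from a₁ towards a₂. The only edges leaving
-- C₁ end in x or y, so the path stays in the fragment G₁ until it reaches one of them,
-- say x, and then leaves G₁. Afterwards it can re-enter C₁ only through y, and would then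
-- be trapped in C₁ and could not end at a₂ ∉ G₁. Hence every vertex of G₁ lies on the
-- initial segment, except possibly y, which is appended through the edge xy.
-- That a₁ lies in C₁ rather than in {x,y} holds because otherwise a hamiltonian path of
-- G − y from x (or of G from x to y) would contain a path of G − {x,y} meeting both C₁ and C₂.

open import Defs hiding (sym)
open import Data.Nat using (ℕ)
open import Data.Fin using (Fin; _≟_)
open import Data.Bool using (true; false; not; _∧_; _∨_)
open import Data.Bool.Properties using (⇔→≡) renaming (_≟_ to _≟ᵇ_)
open import Data.List using (List; []; _∷_; _++_; _∷ʳ_; [_]; head; last; reverse; takeWhile; dropWhile; initLast; _∷ʳ′_)
open import Data.List.Properties using (unfold-reverse; reverse-involutive; takeWhile++dropWhile)
open import Data.List.Relation.Unary.All as All using (All; []; _∷_)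
open import Data.List.Relation.Unary.All.Properties using (all-takeWhile; all-head-dropWhile)
  renaming (++⁺ to All-++⁺; ++⁻ˡ to All-++⁻ˡ; ++⁻ʳ to All-++⁻ʳ)
open import Data.List.Relation.Unary.AllPairs using ([]; _∷_)
open import Data.List.Relation.Unary.Any using (here; there)
open import Data.List.Relation.Unary.Any.Properties using (reverse⁺; reverse⁻)
open import Data.List.Relation.Unary.Unique.Propositional using (Unique)
open import Data.List.Relation.Unary.Unique.Propositional.Properties using () renaming (++⁺ to Unique-++⁺)
open import Data.List.Relation.Binary.Disjoint.Propositional using (Disjoint)
import Data.List.Relation.Binary.Permutation.Setoid as Permutation
import Data.List.Relation.Binary.Permutation.Setoid.Properties as Permutationₚ
open import Data.List.Membership.Propositional using (_∈_; _∉_)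
open import Data.List.Membership.Propositional.Properties using (∈-++⁺ˡ; ∈-++⁺ʳ; ∈-++⁻; ∈-∃++)
open import Data.Maybe using (just)
open import Data.Maybe.Properties using (just-injective)
import Data.Maybe.Relation.Unary.All as Maybe
open import Data.Product using (∃; ∃₂; _×_; _,_; proj₁; proj₂; map₂)
open import Data.Sum using (_⊎_; inj₁; inj₂; [_,_]′) renaming (swap to ⊎-swap; map₂ to ⊎-map₂)
open import Data.Empty using (⊥; ⊥-elim)
open import Function using (_∘_; flip)
open import Function.Bundles using (_⇔_; mk⇔; Equivalence)
open import Function.Properties.Equivalence using () renaming (trans to ⇔-trans)
open import Relation.Nullary using (¬_; Dec; yes; no)
open import Relation.Nullary.Decidable using (⌊_⌋) renaming (map to Dec-map)
open import Relation.Unary using (Decidable; ∁)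
open import Relation.Binary.PropositionalEquality using (_≡_; _≢_; refl; sym; trans; cong; subst)
open import Relation.Binary.PropositionalEquality.Properties using (setoid)

open Equivalence using (to; from)

module _ {A : Set} where

  last-∈ : ∀ {w : A} xs → last xs ≡ just w → w ∈ xs
  last-∈ (x ∷ [])     refl = here refl
  last-∈ (x ∷ y ∷ xs) eq   = there (last-∈ (y ∷ xs) eq)

  All-last : ∀ {P : A → Set} {xs w} → All P xs → last xs ≡ just w → P w
  All-last {xs = xs} ps eq = All.lookup ps (last-∈ xs eq)

  head-satisfies : ∀ {P : A → Set} {xs w} → Maybe.All P (head xs) → head xs ≡ just w → P w
  head-satisfies {xs = _ ∷ _} p refl = Maybe.drop-just p

  last-∷-just : ∀ (x : A) xs → ∃ λ w → last (x ∷ xs) ≡ just w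
  last-∷-just x []       = x , refl
  last-∷-just x (y ∷ xs) = last-∷-just y xs

  ∈⇒last≡just : ∀ {x : A} {xs} → x ∈ xs → ∃ λ w → last xs ≡ just w
  ∈⇒last≡just {xs = x ∷ xs} _ = last-∷-just x xs

  last-++-∷ : ∀ (xs : List A) y ys → last (xs ++ y ∷ ys) ≡ last (y ∷ ys)
  last-++-∷ []           y ys = refl
  last-++-∷ (x ∷ [])     y ys = refl
  last-++-∷ (x ∷ x′ ∷ xs) y ys = last-++-∷ (x′ ∷ xs) y ys

  last-∷ʳ : ∀ (xs : List A) y → last (xs ∷ʳ y) ≡ just y
  last-∷ʳ xs y = last-++-∷ xs y []

  head-++ : ∀ {w : A} xs ys → head xs ≡ just w → head (xs ++ ys) ≡ just w
  head-++ (x ∷ xs) ys eq = eq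

  last-reverse : ∀ (xs : List A) → last (reverse xs) ≡ head xs
  last-reverse []       = refl
  last-reverse (x ∷ xs) rewrite unfold-reverse x xs = last-∷ʳ (reverse xs) x

  head-reverse : ∀ (xs : List A) → head (reverse xs) ≡ last xs
  head-reverse xs = trans (sym (last-reverse (reverse xs))) (cong last (reverse-involutive xs))

  Consec-++ˡ : ∀ {u w : A} {xs ys} → Consec xs u w → Consec (xs ++ ys) u w
  Consec-++ˡ here      = here
  Consec-++ˡ (there c) = there (Consec-++ˡ c)

  Consec-++ʳ : ∀ {u w : A} xs {ys} → Consec ys u w → Consec (xs ++ ys) u w
  Consec-++ʳ []       c = c
  Consec-++ʳ (x ∷ xs) c = there (Consec-++ʳ xs c)

  Consec-join : ∀ {u w : A} xs ys → last xs ≡ just u → head ys ≡ just w → Consec (xs ++ ys) u w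
  Consec-join (x ∷ [])      (y ∷ ys) refl refl = here
  Consec-join (x ∷ x′ ∷ xs) ys       eq   eq′  = there (Consec-join (x′ ∷ xs) ys eq eq′)

  Consec-∷ʳ⁻ : ∀ {u w y : A} xs → Consec (xs ∷ʳ y) u w → Consec xs u w ⊎ (last xs ≡ just u × w ≡ y)
  Consec-∷ʳ⁻ []            (there ())
  Consec-∷ʳ⁻ (x ∷ [])      here              = inj₂ (refl , refl)
  Consec-∷ʳ⁻ (x ∷ [])      (there (there ()))
  Consec-∷ʳ⁻ (x ∷ x′ ∷ xs) here              = inj₁ here
  Consec-∷ʳ⁻ (x ∷ x′ ∷ xs) (there c) with Consec-∷ʳ⁻ (x′ ∷ xs) c
  ... | inj₁ c′ = inj₁ (there c′)
  ... | inj₂ p  = inj₂ p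

  Consec-reverse⁻ : ∀ {u w : A} xs → Consec (reverse xs) u w → Consec xs w u
  Consec-reverse⁻ (x ∷ xs) c rewrite unfold-reverse x xs with Consec-∷ʳ⁻ (reverse xs) c
  ... | inj₁ c′           = there (Consec-reverse⁻ xs c′)
  ... | inj₂ (eq , refl)  = Consec-join [ x ] xs refl (trans (sym (last-reverse xs)) eq)

  Unique-reverse : ∀ {xs : List A} → Unique xs → Unique (reverse xs)
  Unique-reverse {xs} = Permutationₚ.Unique-resp-↭ (setoid A)
    (Permutation.↭-sym (setoid A) (Permutationₚ.↭-reverse (setoid A) xs))

  Unique-++⁻ : ∀ xs {ys : List A} → Unique (xs ++ ys) → Unique xs × Unique ys × Disjoint xs ys
  Unique-++⁻ []       u = [] , u , λ ()
  Unique-++⁻ (x ∷ xs) (x∉ ∷ u) with Unique-++⁻ xs u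
  ... | uxs , uys , xs#ys = All-++⁻ˡ xs x∉ ∷ uxs , uys ,
        λ { (here refl , m) → All.lookup (All-++⁻ʳ xs x∉) m refl ; (there m , m′) → xs#ys (m , m′) }

  maximal-prefix : ∀ {P : A → Set} → Decidable P → ∀ xs →
                   ∃₂ λ ys zs → xs ≡ ys ++ zs × All P ys × Maybe.All (∁ P) (head zs)
  maximal-prefix P? xs = takeWhile P? xs , dropWhile P? xs , sym (takeWhile++dropWhile P? xs)
                       , all-takeWhile P? xs , all-head-dropWhile P? xs

module _ {n : ℕ} where

  Chain-++ˡ : ∀ {R : ESet n} {xs} ys → Chain R (xs ++ ys) → Chain R xs
  Chain-++ˡ ys ch u w c = ch u w (Consec-++ˡ c)

  Chain-++ʳ : ∀ {R : ESet n} xs {ys} → Chain R (xs ++ ys) → Chain R ys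
  Chain-++ʳ xs ch u w c = ch u w (Consec-++ʳ xs c)

  Chain-tail : ∀ {R : ESet n} {x xs} → Chain R (x ∷ xs) → Chain R xs
  Chain-tail ch u w c = ch u w (there c)

  ─-true⇔ : ∀ (S : VSet n) v u → ((S ─ v) u ≡ true) ⇔ (S u ≡ true × u ≢ v)
  ─-true⇔ S v u = mk⇔ (⇒ (S u) (u ≟ v)) (λ (Su , u≢v) → ⇐ Su (u ≟ v) u≢v)
    where
      ⇒ : ∀ b (d : Dec (u ≡ v)) → b ∧ not ⌊ d ⌋ ≡ true → b ≡ true × u ≢ v
      ⇒ true (no u≢v) _ = refl , u≢v
      ⇐ : ∀ {b} → b ≡ true → (d : Dec (u ≡ v)) → u ≢ v → b ∧ not ⌊ d ⌋ ≡ true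
      ⇐ refl (yes u≡v) u≢v = ⊥-elim (u≢v u≡v)
      ⇐ refl (no _)    _   = refl

  data InFragment (C : VSet n) (x y u : Fin n) : Set where
    inside : C u ≡ true → InFragment C x y u
    at₁    : u ≡ x → InFragment C x y u
    at₂    : u ≡ y → InFragment C x y u

  InFragment-swap : ∀ {C x y u} → InFragment C x y u → InFragment C y x u
  InFragment-swap (inside c) = inside c
  InFragment-swap (at₁ eq)   = at₂ eq
  InFragment-swap (at₂ eq)   = at₁ eq

  fragment-true⇔ : ∀ C x y u → (fragment C x y u ≡ true) ⇔ InFragment C x y u
  fragment-true⇔ C x y u = mk⇔ (⇒ (C u) refl (u ≟ x) (u ≟ y)) (⇐ (C u) refl (u ≟ x) (u ≟ y))
    where
      ⇒ : ∀ b → C u ≡ b → (dx : Dec (u ≡ x)) (dy : Dec (u ≡ y))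
        → b ∨ ⌊ dx ⌋ ∨ ⌊ dy ⌋ ≡ true → InFragment C x y u
      ⇒ true  Cu _          _          _ = inside Cu
      ⇒ false _  (yes u≡x) _          _ = at₁ u≡x
      ⇒ false _  (no _)    (yes u≡y) _ = at₂ u≡y
      ⇐ : ∀ b → C u ≡ b → (dx : Dec (u ≡ x)) (dy : Dec (u ≡ y))
        → InFragment C x y u → b ∨ ⌊ dx ⌋ ∨ ⌊ dy ⌋ ≡ true
      ⇐ true  _  _         _         _          = refl
      ⇐ false _  (yes _)   _         _          = refl
      ⇐ false _  (no _)    (yes _)   _          = refl
      ⇐ false Cu (no _)    (no _)    (inside c) with () ← trans (sym Cu) c
      ⇐ false _  (no u≢x)  (no _)    (at₁ u≡x)  = ⊥-elim (u≢x u≡x)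
      ⇐ false _  (no _)    (no u≢y)  (at₂ u≡y)  = ⊥-elim (u≢y u≡y)

  InFragment? : ∀ C x y → Decidable (InFragment C x y)
  InFragment? C x y u = Dec-map (fragment-true⇔ C x y u) (fragment C x y u ≟ᵇ true)

  Avoids : Fin n → Fin n → Fin n → Set
  Avoids s t u = u ≢ s × u ≢ t

  DisjointSets : VSet n → VSet n → Set
  DisjointSets C D = ∀ {u} → C u ≡ true → D u ≡ true → ⊥

  FragmentRestriction : VSet n → Fin n → Fin n → VSet n → VSet n → Set
  FragmentRestriction C s t S T = ∀ u → (T u ≡ true) ⇔ (S u ≡ true × InFragment C s t u)

  FragmentRestriction-swap : ∀ {C s t S T} → FragmentRestriction C s t S T → FragmentRestriction C t s S T
  FragmentRestriction-swap res u =
    mk⇔ (map₂ InFragment-swap ∘ to (res u)) (from (res u) ∘ map₂ InFragment-swap)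

  fragment-restricts-full : ∀ C x y → FragmentRestriction C x y full (fragment C x y)
  fragment-restricts-full C x y u = mk⇔ (λ Fu → refl , to (fragment-true⇔ C x y u) Fu)
                                        (from (fragment-true⇔ C x y u) ∘ proj₂)

  fragment-restricts-─ : ∀ C x y v → FragmentRestriction C x y (full ─ v) (fragment C x y ─ v)
  fragment-restricts-─ C x y v u = mk⇔
    (λ h → let (Fu , u≢v) = to (─-true⇔ (fragment C x y) v u) h in
      from (─-true⇔ full v u) (refl , u≢v) , to (fragment-true⇔ C x y u) Fu)
    (λ (h , Fu) → from (─-true⇔ (fragment C x y) v u)
      (from (fragment-true⇔ C x y u) Fu , proj₂ (to (─-true⇔ full v u) h)))

module _ {n : ℕ} (G : Graph n) where

  open import Data.List.Membership.DecPropositional (_≟_ {n}) using (_∈?_)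

  adj-sym : ∀ {u w} → adj G u w ≡ true → adj G w u ≡ true
  adj-sym {u} {w} = trans (Graph.sym G w u)

  HamPath-reverse : ∀ {S a b} → HamPath G S a b → HamPath G S b a
  HamPath-reverse (vs , (u , mem) , ch , hd , lt) =
      reverse vs
    , (Unique-reverse u , λ z → ⇔-trans (mk⇔ reverse⁻ reverse⁺) (mem z))
    , (λ p q c → adj-sym (ch q p (Consec-reverse⁻ vs c)))
    , trans (head-reverse vs) lt
    , trans (last-reverse vs) hd

  HamPathsBetween : Fin n → Fin n → Set
  HamPathsBetween a b = HamPath G full a b × (∀ z → z ≢ a → z ≢ b → HamPath G (full ─ z) a b)

  HamPathsBetween-sym : ∀ {a b} → HamPathsBetween a b → HamPathsBetween b a
  HamPathsBetween-sym (P , Pz) = HamPath-reverse P , λ z z≢b z≢a → HamPath-reverse (Pz z z≢a z≢b)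

  chain-propagates : ∀ {P Q : Fin n → Set} → (∀ {u w} → P u → adj G u w ≡ true → Q w → P w)
                   → ∀ {h L} → Chain (adj G) (h ∷ L) → All Q L → P h → All P (h ∷ L)
  chain-propagates step {L = []}     ch []         Ph = Ph ∷ []
  chain-propagates step {L = h′ ∷ L} ch (Qh′ ∷ Qs) Ph =
    Ph ∷ chain-propagates step (Chain-tail ch) Qs (step Ph (ch _ _ here) Qh′)

  SeparatedBy : VSet n → Fin n → Fin n → Set
  SeparatedBy C s t = ∀ {u w} → C u ≡ true → adj G u w ≡ true → InFragment C s t w

  SeparatedBy-swap : ∀ {C s t} → SeparatedBy C s t → SeparatedBy C t s
  SeparatedBy-swap sep Cu e = InFragment-swap (sep Cu e)

  record Side (C : VSet n) (s t : Fin n) : Set where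
    field
      separated : SeparatedBy C s t
      avoids    : ∀ {u} → C u ≡ true → Avoids s t u
      nonempty  : ∃ λ c → C c ≡ true

  Side-swap : ∀ {C s t} → Side C s t → Side C t s
  Side-swap side = record
    { separated = SeparatedBy-swap separated
    ; avoids    = λ Cu → let (u≢s , u≢t) = avoids Cu in u≢t , u≢s
    ; nonempty  = nonempty
    }
    where open Side side

  chain-stays-in : ∀ {C s t} → SeparatedBy C s t → ∀ {h L} → Chain (adj G) (h ∷ L)
                 → All (Avoids s t) L → C h ≡ true → All (λ z → C z ≡ true) (h ∷ L)
  chain-stays-in {C} {s} {t} sep = chain-propagates step
    where
      step : ∀ {u w} → C u ≡ true → adj G u w ≡ true → Avoids s t w → C w ≡ true
      step Cu e (w≢s , w≢t) with sep Cu e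
      ... | inside Cw = Cw
      ... | at₁ w≡s   = ⊥-elim (w≢s w≡s)
      ... | at₂ w≡t   = ⊥-elim (w≢t w≡t)

  chain-ends-in : ∀ {C s t c w} → SeparatedBy C s t → C c ≡ true → ∀ M → c ∈ M
                → Chain (adj G) M → All (Avoids s t) M → last M ≡ just w → C w ≡ true
  chain-ends-in sep Cc M c∈M ch av lt with ∈-∃++ c∈M
  ... | A , B , refl = All-last (chain-stays-in sep (Chain-++ʳ A ch) (All.tail (All-++⁻ʳ A av)) Cc)
                                (trans (sym (last-++-∷ A _ B)) lt)

  no-chain-joins-sides : ∀ {C D s t} → Side C s t → Side D s t → DisjointSets C D
                       → ∀ M → Chain (adj G) M → All (Avoids s t) M → (∀ u → Avoids s t u → u ∈ M)
                       → ⊥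
  no-chain-joins-sides {s = s} {t} sC sD C#D M ch av covers = C#D (ends-in sC) (ends-in sD)
    where
      element-on-M : ∀ {E} → Side E s t → ∃ λ c → E c ≡ true × c ∈ M
      element-on-M sE = let (c , Ec) = Side.nonempty sE in c , Ec , covers c (Side.avoids sE Ec)
      last-M : ∃ λ w → last M ≡ just w
      last-M = ∈⇒last≡just (proj₂ (proj₂ (element-on-M sC)))
      ends-in : ∀ {E} → Side E s t → E (proj₁ last-M) ≡ true
      ends-in sE = let (c , Ec , c∈M) = element-on-M sE in
        chain-ends-in (Side.separated sE) Ec M c∈M ch av (proj₂ last-M)

  hamPath-start-avoids : ∀ {C D s t a b} → s ≢ t → Side C s t → Side D s t → DisjointSets C D
                       → HamPathsBetween a b → a ≢ s
  hamPath-start-avoids {s = s} {t} {b = b} s≢t sC sD C#D (P , Pz) refl with b ≟ t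
  ... | no b≢t = tail-joins-sides (Pz t (s≢t ∘ sym) (b≢t ∘ sym))
    where
      tail-joins-sides : HamPath G (full ─ t) s b → ⊥
      tail-joins-sides (_ ∷ rest , (s∉rest ∷ _ , mem) , ch , refl , _) =
        no-chain-joins-sides sC sD C#D rest (Chain-tail ch) avoid cover
        where
          avoid : All (Avoids s t) rest
          avoid = All.tabulate λ {u} m →
            (λ u≡s → All.lookup s∉rest m (sym u≡s)) , proj₂ (to (─-true⇔ full t u) (to (mem u) (there m)))
          cover : ∀ u → Avoids s t u → u ∈ rest
          cover u (u≢s , u≢t) with from (mem u) (from (─-true⇔ full t u) (refl , u≢t))
          ... | here u≡s = ⊥-elim (u≢s u≡s)
          ... | there m  = m
  ... | yes refl = interior-joins-sides P
    where
      interior-joins-sides : HamPath G full s t → ⊥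
      interior-joins-sides (_ ∷ rest , (s∉rest ∷ u , mem) , ch , refl , lt) with initLast rest
      ... | []        = s≢t (just-injective lt)
      ... | M ∷ʳ′ t′  with just-injective (trans (sym (last-∷ʳ (s ∷ M) t′)) lt)
      ... | refl      = no-chain-joins-sides sC sD C#D M (Chain-++ˡ [ t ] (Chain-tail ch)) avoid cover
        where
          avoid : All (Avoids s t) M
          avoid = All.tabulate λ m →
              (λ u≡s → All.lookup s∉rest (∈-++⁺ˡ m) (sym u≡s))
            , (λ u≡t → proj₂ (proj₂ (Unique-++⁻ M u)) (m , here u≡t))
          cover : ∀ v → Avoids s t v → v ∈ M
          cover v (v≢s , v≢t) with from (mem v) refl
          ... | here v≡s = ⊥-elim (v≢s v≡s)
          ... | there m  with ∈-++⁻ M m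
          ...   | inj₁ v∈M       = v∈M
          ...   | inj₂ (here v≡t) = ⊥-elim (v≢t v≡t)

  chain-misses-side : ∀ {C s t b} → SeparatedBy C s t → ∀ h L → Chain (adj G) (h ∷ L) → Unique (h ∷ L)
                    → All (_≢ s) (h ∷ L) → last (h ∷ L) ≡ just b → ¬ InFragment C s t b
                    → C h ≢ true → All (λ z → C z ≢ true) (h ∷ L)
  chain-misses-side sep h []       _  _          _           _  _   ¬Ch = ¬Ch ∷ []
  chain-misses-side {C} {s} {t} sep h (h′ ∷ L) ch (h∉ ∷ uL) (h≢s ∷ ≢s) lt b∉F ¬Ch with C h′ ≟ᵇ true
  ... | no ¬Ch′ = ¬Ch ∷ chain-misses-side sep h′ L (Chain-tail ch) uL ≢s lt b∉F ¬Ch′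
  ... | yes Ch′ with sep Ch′ (adj-sym (ch h h′ here))
  ...   | inside Ch = ⊥-elim (¬Ch Ch)
  ...   | at₁ h≡s   = ⊥-elim (h≢s h≡s)
  -- C was entered from t, so with s and t both behind, the rest of the chain is trapped in C.
  ...   | at₂ h≡t   = ⊥-elim (b∉F (inside (All-last (chain-stays-in sep (Chain-tail ch) avoid Ch′) lt)))
    where
      avoid : All (Avoids s t) L
      avoid = All.zipWith (λ (z≢s , h≢z) → z≢s , λ z≡t → h≢z (trans h≡t (sym z≡t)))
                          (All.tail ≢s , All.tail h∉)

  cut-at-attachment : ∀ {C s t S T a b} → SeparatedBy C s t → adj G s t ≡ true → FragmentRestriction C s t S T
                    → ∀ P R → Enumerates S (P ++ R) → Chain (adj G) (P ++ R)
                    → All (InFragment C s t) P → head P ≡ just a → last P ≡ just s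
                    → Maybe.All (∁ (InFragment C s t)) (head R) → last R ≡ just b → ¬ InFragment C s t b
                    → HamPath G T a s ⊎ HamPath G T a t
  cut-at-attachment sep st res P [] _ _ _ _ _ _ () _
  cut-at-attachment {C} {s} {t} {S} {T} {a} sep st res P (r ∷ R) (u , mem) ch inP hd lastP (Maybe.just r∉F)
                    lastR b∉F with Unique-++⁻ P u
  ... | uP , uR , P#R = close (t ∈? (r ∷ R))
    where
      s∉R : s ∉ r ∷ R
      s∉R s∈R = P#R (last-∈ P lastP , s∈R)
      R-misses-C : All (λ z → C z ≢ true) (r ∷ R)
      R-misses-C = chain-misses-side sep r R (Chain-++ʳ P ch) uR
                     (All.tabulate (λ m z≡s → s∉R (subst (_∈ r ∷ R) z≡s m))) lastR b∉F (r∉F ∘ inside)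
      R∩F⊆t : ∀ {v} → v ∈ r ∷ R → InFragment C s t v → v ≡ t
      R∩F⊆t m (inside Cv) = ⊥-elim (All.lookup R-misses-C m Cv)
      R∩F⊆t m (at₁ refl)  = ⊥-elim (s∉R m)
      R∩F⊆t m (at₂ v≡t)   = v≡t
      in-P : ∀ {v} → v ∈ P → S v ≡ true × InFragment C s t v
      in-P m = to (mem _) (∈-++⁺ˡ m) , All.lookup inP m
      in-S∩F : ∀ {v} → S v ≡ true × InFragment C s t v → v ∈ P ⊎ (v ∈ r ∷ R × v ≡ t)
      in-S∩F {v} (Sv , Fv) = ⊎-map₂ (λ m → m , R∩F⊆t m Fv) (∈-++⁻ P (from (mem v) Sv))
      close : Dec (t ∈ r ∷ R) → HamPath G T a s ⊎ HamPath G T a t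
      close (yes t∈R) = inj₂ (P ∷ʳ t , (unique , members) , chain , head-++ P [ t ] hd , last-∷ʳ P t)
        where
          unique : Unique (P ∷ʳ t)
          unique = Unique-++⁺ uP ([] ∷ []) (λ { (m , here refl) → P#R (m , t∈R) })
          in-t : ∀ {v} → v ∈ [ t ] → S v ≡ true × InFragment C s t v
          in-t (here refl) = to (mem t) (∈-++⁺ʳ P t∈R) , at₂ refl
          members : ∀ v → (v ∈ P ∷ʳ t) ⇔ (T v ≡ true)
          members v = mk⇔ (from (res v) ∘ [ in-P , in-t ]′ ∘ ∈-++⁻ P)
                          ([ ∈-++⁺ˡ , (λ (_ , v≡t) → ∈-++⁺ʳ P (here v≡t)) ]′ ∘ in-S∩F ∘ to (res v))
          chain : Chain (adj G) (P ∷ʳ t)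
          chain v w c with Consec-∷ʳ⁻ P c
          ... | inj₁ c′ = ch v w (Consec-++ˡ c′)
          ... | inj₂ (lastP≡v , refl) with just-injective (trans (sym lastP) lastP≡v)
          ...   | refl = st
      close (no t∉R) = inj₁ (P , (uP , members) , Chain-++ˡ (r ∷ R) ch , hd , lastP)
        where
          members : ∀ v → (v ∈ P) ⇔ (T v ≡ true)
          members v = mk⇔ (from (res v) ∘ in-P)
                          ([ (λ m → m) , (λ { (m , refl) → ⊥-elim (t∉R m) }) ]′ ∘ in-S∩F ∘ to (res v))

  fragment-hamPath : ∀ {C s t S T a b} → SeparatedBy C s t → adj G s t ≡ true → FragmentRestriction C s t S T
                   → HamPath G S a b → C a ≡ true → ¬ InFragment C s t b
                   → HamPath G T a s ⊎ HamPath G T a t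
  fragment-hamPath {C} {s} {t} sep st res (vs , enum , ch , hd , lt) Ca b∉F with maximal-prefix (InFragment? C s t) vs
  ... | P , [] , refl , inP , _ = ⊥-elim (b∉F (All-last (All-++⁺ inP []) lt))
  ... | [] , R , refl , _ , R∉F = ⊥-elim (head-satisfies R∉F hd (inside Ca))
  ... | p ∷ P , r ∷ R , refl , inP , R∉F with last-∷-just p P | trans (sym (last-++-∷ (p ∷ P) r R)) lt
  ...   | e , lastP | lastR with All-last inP lastP
  ...     | inside Ce = ⊥-elim (Maybe.drop-just R∉F (sep Ce (ch e r (Consec-join (p ∷ P) (r ∷ R) lastP refl))))
  ...     | at₁ refl  = cut-at-attachment sep st res (p ∷ P) (r ∷ R) enum ch inP hd lastP R∉F lastR b∉F
  ...     | at₂ refl  = ⊎-swap (cut-at-attachment (SeparatedBy-swap sep) (adj-sym st) (FragmentRestriction-swap res)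
                          (p ∷ P) (r ∷ R) enum ch (All.map InFragment-swap inP) hd lastP
                          (Maybe.map (_∘ InFragment-swap) R∉F) lastR (b∉F ∘ InFragment-swap))

  component-⊆ : ∀ {X C D u w} → IsComponentOf G X C → IsComponentOf G X D
              → C u ≡ true → D u ≡ true → C w ≡ true → D w ≡ true
  component-⊆ {C = C} {D} {u} {w} (_ , C⊆X , C-connected , _) (_ , _ , _ , D-closed) Cu Du Cw with C-connected u w Cu Cw
  ... | [] , _ , _ , () , _
  ... | _ ∷ L , ch , inC , refl , lt =
    All-last (chain-propagates step ch (All.tail inC) Du) lt
    where
      step : ∀ {v v′} → D v ≡ true → adj G v v′ ≡ true → C v′ ≡ true → D v′ ≡ true
      step {v} {v′} Dv e Cv′ = D-closed v v′ Dv (C⊆X v′ Cv′) e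

  components-disjoint : ∀ {X C D} → IsComponentOf G X C → IsComponentOf G X D → (∃ λ v → C v ≢ D v)
                      → DisjointSets C D
  components-disjoint kC kD (v , Cv≢Dv) Cu Du =
    Cv≢Dv (⇔→≡ (mk⇔ (component-⊆ kC kD Cu Du) (component-⊆ kD kC Du Cu)))

  component-side : ∀ {x y C} → IsComponentOf G ((full ─ x) ─ y) C → Side C x y
  component-side {x} {y} {C} (nonempty , C⊆X , _ , closed) =
    record { separated = separated ; avoids = avoids ; nonempty = nonempty }
    where
      avoids : ∀ {u} → C u ≡ true → Avoids x y u
      avoids {u} Cu = let (h , u≢y) = to (─-true⇔ (full ─ x) y u) (C⊆X u Cu) in
        proj₂ (to (─-true⇔ full x u) h) , u≢y
      separated : SeparatedBy C x y
      separated {u} {w} Cu e with w ≟ x | w ≟ y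
      ... | yes w≡x | _       = at₁ w≡x
      ... | no _    | yes w≡y = at₂ w≡y
      ... | no w≢x  | no w≢y  =
        inside (closed u w Cu (from (─-true⇔ (full ─ x) y w) (from (─-true⇔ full x w) (refl , w≢x) , w≢y))
                       e)

  hamPath-start-in-side : ∀ {C D x y a b} → x ≢ y → Side C x y → Side D x y → DisjointSets C D
                        → fragment C x y a ≡ true → HamPathsBetween a b → C a ≡ true
  hamPath-start-in-side {C} {x = x} {y} {a} x≢y sC sD C#D Fa joined with to (fragment-true⇔ C x y a) Fa
  ... | inside Ca = Ca
  ... | at₁ a≡x   = ⊥-elim (hamPath-start-avoids x≢y sC sD C#D joined a≡x)
  ... | at₂ a≡y   = ⊥-elim (hamPath-start-avoids (x≢y ∘ sym) (Side-swap sC) (Side-swap sD) C#D joined a≡y)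

  fragment-conclusion : ∀ {C D x y a b} → x ≢ y → adj G x y ≡ true
                      → Side C x y → Side D x y → DisjointSets C D
                      → fragment C x y a ≡ true → fragment D x y b ≡ true → HamPathsBetween a b
                      → FragmentConclusion G (fragment C x y) a x y
  fragment-conclusion {C} {D} {x} {y} {a} {b} x≢y xy sC sD C#D Fa Fb joined@(P , Pz) =
      fragment-hamPath (Side.separated sC) xy (fragment-restricts-full C x y) P Ca b∉F
    , λ v Fv v≢a →
        fragment-hamPath (Side.separated sC) xy (fragment-restricts-─ C x y v) (Pz v v≢a (v≢b Fv)) Ca b∉F
    where
      Ca : C a ≡ true
      Ca = hamPath-start-in-side x≢y sC sD C#D Fa joined
      Db : D b ≡ true
      Db = hamPath-start-in-side x≢y sD sC (flip C#D) Fb (HamPathsBetween-sym joined)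
      b∉F : ¬ InFragment C x y b
      b∉F (inside Cb) = C#D Cb Db
      b∉F (at₁ b≡x)   = proj₁ (Side.avoids sD Db) b≡x
      b∉F (at₂ b≡y)   = proj₂ (Side.avoids sD Db) b≡y
      v≢b : ∀ {v} → fragment C x y v ≡ true → v ≢ b
      v≢b Fv refl = b∉F (to (fragment-true⇔ C x y _) Fv)

claim3 : ∀ {n} (G : Graph n) (a₁ a₂ x y : Fin n) (C₁ C₂ : VSet n)
    → TwoConnected G → TwoLeafStable G → FaultCostIs G 1
    → HamPath G full a₁ a₂
    → (∀ z → z ≢ a₁ → z ≢ a₂ → HamPath G (full ─ z) a₁ a₂)
    → TwoSeparator G x y → adj G x y ≡ true
    → IsComponentOf G ((full ─ x) ─ y) C₁ → IsComponentOf G ((full ─ x) ─ y) C₂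
    → (∃ λ u → C₁ u ≢ C₂ u)
    → fragment C₁ x y a₁ ≡ true → fragment C₂ x y a₂ ≡ true
    → FragmentConclusion G (fragment C₁ x y) a₁ x y
      × FragmentConclusion G (fragment C₂ x y) a₂ x y
claim3 G a₁ a₂ x y C₁ C₂ _ _ _ P Pz (x≢y , _) xy K₁ K₂ C₁≢C₂ F₁a₁ F₂a₂ =
    fragment-conclusion G x≢y xy side₁ side₂ C₁#C₂ F₁a₁ F₂a₂ (P , Pz)
  , fragment-conclusion G x≢y xy side₂ side₁ (flip C₁#C₂) F₂a₂ F₁a₁ (HamPathsBetween-sym G (P , Pz))
  where
    side₁ : Side G C₁ x y
    side₁ = component-side G K₁
    side₂ : Side G C₂ x y
    side₂ = component-side G K₂
    C₁#C₂ : DisjointSets C₁ C₂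
    C₁#C₂ = components-disjoint G K₁ K₂ C₁≢C₂
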